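{- Let $\lambda$ be a nonzero real parameter and $x$ a variable. For all integers $n,k\ge 0$, \[ \sum_{m=0}^{n}\frac{1}{k!}\,\Delta^k x^m\,\lambda^{n-m}S_1(n,m)=\begin{cases} S_{2,\lambda}(n,k\mid x), & \text{if } n\ge k,\\ 0, & \text{if } n<k.\end{cases} \]
   Context: $S_1(n,m)$ denotes the (signed) Stirling numbers of the first kind, defined by $(x)_n=x(x-1)\cdots(x-n+1)=\sum_{m=0}^n S_1(n,m)x^m$ (with $(x)_0=1$). $\Delta$ is the forward difference operator $\Delta f(x)=f(x+1)-f(x)$, so $\Delta^k f(x)=\sum_{l=0}^k\binom{k}{l}(-1)^{k-l}f(x+l)$; here $\Delta^k x^m$ means $\Delta^k$ applied to the function $x\mapsto x^m$, evaluated at $x$. The degenerate Stirling polynomials of the second kind $S_{2,\lambda}(n,k\mid x)$ are defined by \[ \frac{1}{k!}(1+\lambda t)^{x/\lambda}\big((1+\lambda t)^{1/\lambda}-1\big)^k=\sum_{n=k}^{\infty}S_{2,\lambda}(n,k\mid x)\frac{t^n}{n!}. \]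
   Formalization: The nonzero parameter λ is rational rather than real, and the variable x likewise ranges over the rationals. -}

module Defs where

open import Data.Nat as ℕ using (ℕ; zero; suc; _!)
open import Data.Nat.Properties using (_!≢0)
open import Data.Nat.Combinatorics using (_C_)
open import Data.Integer as ℤ using (ℤ; +_)
open import Data.Rational as ℚ using (ℚ; 0ℚ; 1ℚ; _+_; _*_; _-_; -_; _/_; 1/_; _÷_; NonZero)

ℕ→ℚ : ℕ → ℚ
ℕ→ℚ n = (+ n) / 1

ℤ→ℚ : ℤ → ℚ
ℤ→ℚ z = z / 1

inv! : ℕ → ℚ
inv! n = (+ 1) / (n !) where instance _ = n !≢0

_^ℚ_ : ℚ → ℕ → ℚ
a ^ℚ zero  = 1ℚ
a ^ℚ suc n = (a ^ℚ n) * a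

sumTo : ℕ → (ℕ → ℚ) → ℚ
sumTo zero    f = f 0
sumTo (suc n) f = sumTo n f + f (suc n)

sign : ℕ → ℚ
sign zero    = 1ℚ
sign (suc j) = - sign j

-- Signed Stirling numbers of the first kind, as coefficients of the
-- falling factorial (x)_n = x(x-1)...(x-n+1) = Σ_m S1(n,m) x^m.
-- fallCoeff n m is the coefficient of x^m in (x)_n, computed by
-- multiplying coefficient sequences: (x)_{n+1} = (x)_n · (x - n).

fallCoeff : ℕ → ℕ → ℤ
fallCoeff zero    zero    = + 1
fallCoeff zero    (suc m) = + 0
fallCoeff (suc n) zero    = ℤ.- ((+ n) ℤ.* fallCoeff n zero)
fallCoeff (suc n) (suc m) = fallCoeff n m ℤ.- ((+ n) ℤ.* fallCoeff n (suc m))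

S₁ : ℕ → ℕ → ℤ
S₁ = fallCoeff

Δ^ : ℕ → (ℚ → ℚ) → ℚ → ℚ
Δ^ k f x = sumTo k (λ l → ℕ→ℚ (k C l) * sign (k ℕ.∸ l) * f (x + ℕ→ℚ l))

-- Formal power series over ℚ (coefficient sequences) in t.

Series : Set
Series = ℕ → ℚ

_⊛_ : Series → Series → Series
(f ⊛ g) n = sumTo n (λ i → f i * g (n ℕ.∸ i))

oneS : Series
oneS zero    = 1ℚ
oneS (suc n) = 0ℚ

_^S_ : Series → ℕ → Series
f ^S zero  = oneS
f ^S suc k = (f ^S k) ⊛ f

fallℚ : ℚ → ℕ → ℚ
fallℚ a zero    = 1ℚ
fallℚ a (suc n) = fallℚ a n * (a - ℕ→ℚ n)

binomℚ : ℚ → ℕ → ℚ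
binomℚ a n = fallℚ a n * inv! n

-- binomial series (1 + u t)^a = Σ_n binom(a,n) u^n t^n
binomSeries : ℚ → ℚ → Series
binomSeries u a n = binomℚ a n * (u ^ℚ n)

-- Degenerate Stirling polynomials of the second kind:
-- (1/k!) (1+λt)^{x/λ} ((1+λt)^{1/λ} - 1)^k = Σ_n S_{2,λ}(n,k|x) t^n / n!
S₂λ : (lam : ℚ) → .{{NonZero lam}} → ℕ → ℕ → ℚ → ℚ
S₂λ lam n k x = ℕ→ℚ (n !) * (inv! k * ((A ⊛ (B ^S k)) n))
  where
  A : Series
  A = binomSeries lam (x ÷ lam)
  E : Series
  E = binomSeries lam (1/ lam)
  B : Series
  B m = E m - oneS m

{-# OPTIONS --safe #-}
-- Both sides equal (1/k!) Δ^k (x)_{n,λ}, where (y)_{n,λ} = y (y − λ) ⋯ (y − (n−1)λ).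
--
-- On the left, λ^{n−m} S₁(n,m) is the coefficient of y^m in (y)_{n,λ}, and Δ^k is linear.
--
-- On the right, (1 + λt)^{a/λ} = e_λ^a(t) := Σₙ (a)_{n,λ} tⁿ/n!.  Its coefficients obey
-- (n+1) c_{n+1} = (a − nλ) c_n, which determines the series from c₀ = 1; by the Leibniz rule
-- e_λ^a e_λ^b obeys the recurrence for a + b, so e_λ^a e_λ^b = e_λ^{a+b}.  Hence
-- (e_λ^1 − 1)^k = Σ_l C(k,l) (−1)^{k−l} e_λ^l and e_λ^x (e_λ^1 − 1)^k = Δ^k e_λ^x.
-- For n < k both sides vanish because e_λ^1 − 1 has no constant term.
module Submission where

open import Defs
open import Data.Nat using (ℕ; _≤_; _<_; _∸_)
open import Data.Product using (_×_; _,_)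
open import Data.Rational using (ℚ; 0ℚ; _*_; NonZero)
open import Relation.Binary.PropositionalEquality using (_≡_)

open import Level using (0ℓ)
open import Data.Nat as ℕ using (zero; suc; _!; z≤n; s≤s)
import Data.Nat.Properties as ℕ
open import Data.Nat.Combinatorics using (_C_; k>n⇒nCk≡0; nCk+nC[k+1]≡[n+1]C[k+1])
open import Data.Nat.Coprimality using (1-coprimeTo) renaming (sym to coprime-sym)
open import Data.Integer as ℤ using (+_; -[1+_])
import Data.Integer.Properties as ℤ
open import Data.Rational using (_+_; -_; _-_; 1ℚ; 1/_; _÷_; mkℚ)
open import Data.Rational.Properties
open import Relation.Binary.PropositionalEquality using (refl; sym; trans; cong; cong₂; module ≡-Reasoning)
open import Relation.Nullary using (yes; no)
open import Relation.Nullary.Decidable using (dec⇒maybe)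
open import Tactic.RingSolver using (solve-∀)
open import Tactic.RingSolver.Core.AlmostCommutativeRing using (AlmostCommutativeRing; fromCommutativeRing)
open ≡-Reasoning

ℚ-ring : AlmostCommutativeRing 0ℓ 0ℓ
ℚ-ring = fromCommutativeRing +-*-commutativeRing (λ p → dec⇒maybe (0ℚ ≟ p))

-- z / 1 is already normalised, and on the raw fraction mkℚ z 0 _ the operations of ℚ compute.
ℤ→ℚ≡mkℚ : ∀ z → ℤ→ℚ z ≡ mkℚ z 0 (coprime-sym (1-coprimeTo ℤ.∣ z ∣))
ℤ→ℚ≡mkℚ (+ n)    = normalize-coprime (coprime-sym (1-coprimeTo n))
ℤ→ℚ≡mkℚ -[1+ n ] = cong -_ (normalize-coprime (coprime-sym (1-coprimeTo (suc n))))

ℤ→ℚ-homo-+ : ∀ a b → ℤ→ℚ (a ℤ.+ b) ≡ ℤ→ℚ a + ℤ→ℚ b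
ℤ→ℚ-homo-+ a b rewrite ℤ→ℚ≡mkℚ a | ℤ→ℚ≡mkℚ b =
  cong (Data.Rational._/ 1) (sym (cong₂ ℤ._+_ (ℤ.*-identityʳ a) (ℤ.*-identityʳ b)))

ℤ→ℚ-homo-* : ∀ a b → ℤ→ℚ (a ℤ.* b) ≡ ℤ→ℚ a * ℤ→ℚ b
ℤ→ℚ-homo-* a b rewrite ℤ→ℚ≡mkℚ a | ℤ→ℚ≡mkℚ b = refl

ℤ→ℚ-homo‿- : ∀ a → ℤ→ℚ (ℤ.- a) ≡ - ℤ→ℚ a
ℤ→ℚ-homo‿- (+ zero)  = refl
ℤ→ℚ-homo‿- (+ suc n) = refl
ℤ→ℚ-homo‿- -[1+ n ] rewrite ℤ→ℚ≡mkℚ -[1+ n ] | ℤ→ℚ≡mkℚ (+ suc n) = refl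

ℤ→ℚ-homo-sub : ∀ a b → ℤ→ℚ (a ℤ.- b) ≡ ℤ→ℚ a - ℤ→ℚ b
ℤ→ℚ-homo-sub a b = trans (ℤ→ℚ-homo-+ a (ℤ.- b)) (cong (_+_ (ℤ→ℚ a)) (ℤ→ℚ-homo‿- b))

ℕ→ℚ-homo-+ : ∀ a b → ℕ→ℚ (a ℕ.+ b) ≡ ℕ→ℚ a + ℕ→ℚ b
ℕ→ℚ-homo-+ a b = trans (cong ℤ→ℚ (ℤ.pos-+ a b)) (ℤ→ℚ-homo-+ (+ a) (+ b))

ℕ→ℚ-homo-* : ∀ a b → ℕ→ℚ (a ℕ.* b) ≡ ℕ→ℚ a * ℕ→ℚ b
ℕ→ℚ-homo-* a b = trans (cong ℤ→ℚ (ℤ.pos-* a b)) (ℤ→ℚ-homo-* (+ a) (+ b))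

ℕ→ℚ-suc : ∀ a → ℕ→ℚ (suc a) ≡ ℕ→ℚ a + 1ℚ
ℕ→ℚ-suc a = trans (cong ℕ→ℚ (ℕ.+-comm 1 a)) (ℕ→ℚ-homo-+ a 1)

ℕ→ℚ-*-inverseʳ : ∀ d .{{_ : ℕ.NonZero d}} → ℕ→ℚ d * ((+ 1) Data.Rational./ d) ≡ 1ℚ
ℕ→ℚ-*-inverseʳ (suc d)
  rewrite ℤ→ℚ≡mkℚ (+ suc d) | normalize-coprime {1} {d} (1-coprimeTo (suc d)) =
  *-inverseʳ (mkℚ (+ suc d) 0 (coprime-sym (1-coprimeTo (suc d))))

ℕ→ℚ-*-cancelˡ : ∀ d .{{_ : ℕ.NonZero d}} {u v} → ℕ→ℚ d * u ≡ ℕ→ℚ d * v → u ≡ v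
ℕ→ℚ-*-cancelˡ d {u} {v} eq = begin
  u                    ≡⟨ reassoc u ⟨
  d⁻¹ * (ℕ→ℚ d * u)    ≡⟨ cong (d⁻¹ *_) eq ⟩
  d⁻¹ * (ℕ→ℚ d * v)    ≡⟨ reassoc v ⟩
  v                    ∎
  where
  d⁻¹ = (+ 1) Data.Rational./ d
  reassoc : ∀ w → d⁻¹ * (ℕ→ℚ d * w) ≡ w
  reassoc w = begin
    d⁻¹ * (ℕ→ℚ d * w)  ≡⟨ *-assoc d⁻¹ (ℕ→ℚ d) w ⟨
    (d⁻¹ * ℕ→ℚ d) * w  ≡⟨ cong (_* w) (trans (*-comm d⁻¹ (ℕ→ℚ d)) (ℕ→ℚ-*-inverseʳ d)) ⟩
    1ℚ * w             ≡⟨ *-identityˡ w ⟩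
    w                  ∎

n!*inv!n≡1 : ∀ n → ℕ→ℚ (n !) * inv! n ≡ 1ℚ
n!*inv!n≡1 n = ℕ→ℚ-*-inverseʳ (n !) {{n ℕ.!≢0}}

[1+n]*inv![1+n]≡inv!n : ∀ n → ℕ→ℚ (suc n) * inv! (suc n) ≡ inv! n
[1+n]*inv![1+n]≡inv!n n = ℕ→ℚ-*-cancelˡ (n !) {{n ℕ.!≢0}} (begin
  ℕ→ℚ (n !) * (ℕ→ℚ (suc n) * inv! (suc n))  ≡⟨ reassoc (ℕ→ℚ (n !)) (ℕ→ℚ (suc n)) (inv! (suc n)) ⟩
  (ℕ→ℚ (suc n) * ℕ→ℚ (n !)) * inv! (suc n)  ≡⟨ cong (_* inv! (suc n)) (ℕ→ℚ-homo-* (suc n) (n !)) ⟨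
  ℕ→ℚ (suc n !) * inv! (suc n)              ≡⟨ n!*inv!n≡1 (suc n) ⟩
  1ℚ                                         ≡⟨ n!*inv!n≡1 n ⟨
  ℕ→ℚ (n !) * inv! n                         ∎)
  where
  reassoc : ∀ a b c → a * (b * c) ≡ (b * a) * c
  reassoc = solve-∀ ℚ-ring

sumTo-cong : ∀ n {f g : ℕ → ℚ} → (∀ i → i ≤ n → f i ≡ g i) → sumTo n f ≡ sumTo n g
sumTo-cong zero    eq = eq 0 z≤n
sumTo-cong (suc n) eq = cong₂ _+_ (sumTo-cong n (λ i i≤n → eq i (ℕ.m≤n⇒m≤1+n i≤n))) (eq (suc n) ℕ.≤-refl)

sumTo-zero : ∀ n {f : ℕ → ℚ} → (∀ i → i ≤ n → f i ≡ 0ℚ) → sumTo n f ≡ 0ℚ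
sumTo-zero zero    eq = eq 0 z≤n
sumTo-zero (suc n) eq = cong₂ _+_ (sumTo-zero n (λ i i≤n → eq i (ℕ.m≤n⇒m≤1+n i≤n))) (eq (suc n) ℕ.≤-refl)

sumTo-+ : ∀ n (f g : ℕ → ℚ) → sumTo n (λ i → f i + g i) ≡ sumTo n f + sumTo n g
sumTo-+ zero    f g = refl
sumTo-+ (suc n) f g = trans (cong (_+ (f (suc n) + g (suc n))) (sumTo-+ n f g))
                            (interchange (sumTo n f) (sumTo n g) (f (suc n)) (g (suc n)))
  where
  interchange : ∀ a b c d → (a + b) + (c + d) ≡ (a + c) + (b + d)
  interchange = solve-∀ ℚ-ring

sumTo-neg : ∀ n (f : ℕ → ℚ) → - sumTo n f ≡ sumTo n (λ i → - f i)
sumTo-neg zero    f = refl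
sumTo-neg (suc n) f = trans (neg-distrib-+ (sumTo n f) (f (suc n))) (cong (_+ - f (suc n)) (sumTo-neg n f))

sumTo-sub : ∀ n (f g : ℕ → ℚ) → sumTo n (λ i → f i - g i) ≡ sumTo n f - sumTo n g
sumTo-sub n f g = trans (sumTo-+ n f (λ i → - g i)) (cong (_+_ (sumTo n f)) (sym (sumTo-neg n g)))

sumTo-*ˡ : ∀ n c (f : ℕ → ℚ) → c * sumTo n f ≡ sumTo n (λ i → c * f i)
sumTo-*ˡ zero    c f = refl
sumTo-*ˡ (suc n) c f = trans (*-distribˡ-+ c (sumTo n f) (f (suc n))) (cong (_+ c * f (suc n)) (sumTo-*ˡ n c f))

sumTo-*ʳ : ∀ n c (f : ℕ → ℚ) → sumTo n f * c ≡ sumTo n (λ i → f i * c)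
sumTo-*ʳ n c f = trans (*-comm (sumTo n f) c) (trans (sumTo-*ˡ n c f) (sumTo-cong n (λ i _ → *-comm c (f i))))

sumTo-suc-shift : ∀ n (f : ℕ → ℚ) → sumTo (suc n) f ≡ f 0 + sumTo n (λ i → f (suc i))
sumTo-suc-shift zero    f = refl
sumTo-suc-shift (suc n) f =
  trans (cong (_+ f (suc (suc n))) (sumTo-suc-shift n f)) (+-assoc (f 0) _ (f (suc (suc n))))

sumTo-comm : ∀ n k (F : ℕ → ℕ → ℚ) → sumTo n (λ i → sumTo k (F i)) ≡ sumTo k (λ j → sumTo n (λ i → F i j))
sumTo-comm zero    k F = refl
sumTo-comm (suc n) k F =
  trans (cong (_+ sumTo k (F (suc n))) (sumTo-comm n k F)) (sym (sumTo-+ k (λ j → sumTo n (λ i → F i j)) (F (suc n))))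

Δ-coeff : ℕ → ℕ → ℚ
Δ-coeff k l = ℕ→ℚ (k C l) * sign (k ∸ l)

-- Δ^ k f x ≡ Δ^seq k (λ l → f (x + ℕ→ℚ l)) holds definitionally.
Δ^seq : ℕ → (ℕ → ℚ) → ℚ
Δ^seq k h = sumTo k (λ l → Δ-coeff k l * h l)

Δ^seq-cong : ∀ k {g h : ℕ → ℚ} → (∀ l → g l ≡ h l) → Δ^seq k g ≡ Δ^seq k h
Δ^seq-cong k eq = sumTo-cong k (λ l _ → cong (Δ-coeff k l *_) (eq l))

Δ^seq-*ˡ : ∀ k c (h : ℕ → ℚ) → c * Δ^seq k h ≡ Δ^seq k (λ l → c * h l)
Δ^seq-*ˡ k c h = trans (sumTo-*ˡ k c _) (sumTo-cong k (λ l _ → swap c (Δ-coeff k l) (h l)))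
  where
  swap : ∀ c a b → c * (a * b) ≡ a * (c * b)
  swap = solve-∀ ℚ-ring

Δ^seq-*ʳ : ∀ k c (h : ℕ → ℚ) → Δ^seq k h * c ≡ Δ^seq k (λ l → h l * c)
Δ^seq-*ʳ k c h = trans (sumTo-*ʳ k c _) (sumTo-cong k (λ l _ → *-assoc (Δ-coeff k l) (h l) c))

Δ^seq-sum : ∀ n k (H : ℕ → ℕ → ℚ) → sumTo n (λ m → Δ^seq k (H m)) ≡ Δ^seq k (λ l → sumTo n (λ m → H m l))
Δ^seq-sum n k H = trans (sumTo-comm n k _) (sumTo-cong k (λ l _ → sym (sumTo-*ˡ n (Δ-coeff k l) (λ m → H m l))))

-- By Pascal's rule C(k+1,l+1) = C(k,l) + C(k,l+1).
Δ^seq-suc : ∀ k (h : ℕ → ℚ) → Δ^seq (suc k) h ≡ Δ^seq k (λ l → h (suc l) - h l)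
Δ^seq-suc k h = sym (begin
  Δ^seq k (λ l → h (suc l) - h l)
    ≡⟨ sumTo-cong k (λ l _ → *-distribˡ-+ (Δ-coeff k l) (h (suc l)) (- h l)) ⟩
  sumTo k (λ l → Δ-coeff k l * h (suc l) + Δ-coeff k l * - h l)
    ≡⟨ sumTo-+ k _ _ ⟩
  shifted + sumTo k (λ l → Δ-coeff k l * - h l)
    ≡⟨ cong (_+_ shifted) negated ⟩
  shifted + sumTo (suc k) d
    ≡⟨ cong (_+_ shifted) (sumTo-suc-shift k d) ⟩
  shifted + (d 0 + sumTo k (λ l → d (suc l)))
    ≡⟨ rotate shifted (d 0) _ ⟩
  d 0 + (shifted + sumTo k (λ l → d (suc l)))
    ≡⟨ cong (_+_ (d 0)) (sym (sumTo-+ k _ _)) ⟩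
  d 0 + sumTo k (λ l → Δ-coeff k l * h (suc l) + d (suc l))
    ≡⟨ cong (_+_ (d 0)) (sumTo-cong k (λ l _ → pascal l)) ⟩
  d 0 + sumTo k (λ l → Δ-coeff (suc k) (suc l) * h (suc l))
    ≡⟨ sumTo-suc-shift k (λ l → Δ-coeff (suc k) l * h l) ⟨
  Δ^seq (suc k) h ∎)
  where
  shifted : ℚ
  shifted = sumTo k (λ l → Δ-coeff k l * h (suc l))
  d : ℕ → ℚ
  d l = ℕ→ℚ (k C l) * sign (suc k ∸ l) * h l
  rotate : ∀ a b c → a + (b + c) ≡ b + (a + c)
  rotate = solve-∀ ℚ-ring
  move-neg : ∀ a s x → a * s * - x ≡ a * - s * x
  move-neg = solve-∀ ℚ-ring
  negated : sumTo k (λ l → Δ-coeff k l * - h l) ≡ sumTo (suc k) d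
  negated = begin
    sumTo k (λ l → Δ-coeff k l * - h l)
      ≡⟨ sumTo-cong k (λ l l≤k → trans (move-neg (ℕ→ℚ (k C l)) (sign (k ∸ l)) (h l))
           (cong (λ j → ℕ→ℚ (k C l) * sign j * h l) (sym (ℕ.+-∸-assoc 1 l≤k)))) ⟩
    sumTo k d                ≡⟨ +-identityʳ (sumTo k d) ⟨
    sumTo k d + 0ℚ           ≡⟨ cong (_+_ (sumTo k d)) top ⟨
    sumTo (suc k) d          ∎
    where
    top : d (suc k) ≡ 0ℚ
    top rewrite k>n⇒nCk≡0 (ℕ.n<1+n k) = trans (cong (_* h (suc k)) (*-zeroˡ (sign (k ∸ k)))) (*-zeroˡ (h (suc k)))
  distrib : ∀ a b s x → a * s * x + b * s * x ≡ (a + b) * s * x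
  distrib = solve-∀ ℚ-ring
  pascal : ∀ l → Δ-coeff k l * h (suc l) + d (suc l) ≡ Δ-coeff (suc k) (suc l) * h (suc l)
  pascal l = trans (distrib (ℕ→ℚ (k C l)) (ℕ→ℚ (k C suc l)) (sign (k ∸ l)) (h (suc l)))
    (cong (λ c → c * sign (k ∸ l) * h (suc l))
      (trans (sym (ℕ→ℚ-homo-+ (k C l) (k C suc l))) (cong ℕ→ℚ (nCk+nC[k+1]≡[n+1]C[k+1] k l))))

∂ : Series → Series
∂ f n = ℕ→ℚ (suc n) * f (suc n)

∂-leibniz : ∀ (f g : Series) n → ∂ (f ⊛ g) n ≡ (∂ f ⊛ g) n + (f ⊛ ∂ g) n
∂-leibniz f g n = begin
  ℕ→ℚ (suc n) * sumTo (suc n) T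
    ≡⟨ sumTo-*ˡ (suc n) (ℕ→ℚ (suc n)) T ⟩
  sumTo (suc n) (λ i → ℕ→ℚ (suc n) * T i)
    ≡⟨ sumTo-cong (suc n) split ⟩
  sumTo (suc n) (λ i → ℕ→ℚ i * T i + ℕ→ℚ (suc n ∸ i) * T i)
    ≡⟨ sumTo-+ (suc n) _ _ ⟩
  sumTo (suc n) (λ i → ℕ→ℚ i * T i) + sumTo (suc n) (λ i → ℕ→ℚ (suc n ∸ i) * T i)
    ≡⟨ cong₂ _+_ left right ⟩
  (∂ f ⊛ g) n + (f ⊛ ∂ g) n ∎
  where
  T : ℕ → ℚ
  T i = f i * g (suc n ∸ i)
  split : ∀ i → i ≤ suc n → ℕ→ℚ (suc n) * T i ≡ ℕ→ℚ i * T i + ℕ→ℚ (suc n ∸ i) * T i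
  split i i≤1+n = begin
    ℕ→ℚ (suc n) * T i                      ≡⟨ cong (λ j → ℕ→ℚ j * T i) (ℕ.m+[n∸m]≡n i≤1+n) ⟨
    ℕ→ℚ (i ℕ.+ (suc n ∸ i)) * T i          ≡⟨ cong (_* T i) (ℕ→ℚ-homo-+ i (suc n ∸ i)) ⟩
    (ℕ→ℚ i + ℕ→ℚ (suc n ∸ i)) * T i        ≡⟨ *-distribʳ-+ (T i) (ℕ→ℚ i) (ℕ→ℚ (suc n ∸ i)) ⟩
    ℕ→ℚ i * T i + ℕ→ℚ (suc n ∸ i) * T i    ∎
  left : sumTo (suc n) (λ i → ℕ→ℚ i * T i) ≡ (∂ f ⊛ g) n
  left = begin
    sumTo (suc n) (λ i → ℕ→ℚ i * T i)
      ≡⟨ sumTo-suc-shift n (λ i → ℕ→ℚ i * T i) ⟩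
    0ℚ * T 0 + sumTo n (λ i → ℕ→ℚ (suc i) * T (suc i))
      ≡⟨ cong (_+ sumTo n (λ i → ℕ→ℚ (suc i) * T (suc i))) (*-zeroˡ (T 0)) ⟩
    0ℚ + sumTo n (λ i → ℕ→ℚ (suc i) * T (suc i))
      ≡⟨ +-identityˡ _ ⟩
    sumTo n (λ i → ℕ→ℚ (suc i) * (f (suc i) * g (n ∸ i)))
      ≡⟨ sumTo-cong n (λ i _ → sym (*-assoc (ℕ→ℚ (suc i)) (f (suc i)) (g (n ∸ i)))) ⟩
    (∂ f ⊛ g) n ∎
  exchange : ∀ a b c → a * (b * c) ≡ b * (a * c)
  exchange = solve-∀ ℚ-ring
  right : sumTo (suc n) (λ i → ℕ→ℚ (suc n ∸ i) * T i) ≡ (f ⊛ ∂ g) n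
  right = begin
    sumTo n (λ i → ℕ→ℚ (suc n ∸ i) * T i) + ℕ→ℚ (n ∸ n) * T (suc n)
      ≡⟨ cong (λ j → sumTo n (λ i → ℕ→ℚ (suc n ∸ i) * T i) + ℕ→ℚ j * T (suc n)) (ℕ.n∸n≡0 n) ⟩
    sumTo n (λ i → ℕ→ℚ (suc n ∸ i) * T i) + 0ℚ * T (suc n)
      ≡⟨ cong (_+_ (sumTo n (λ i → ℕ→ℚ (suc n ∸ i) * T i))) (*-zeroˡ (T (suc n))) ⟩
    sumTo n (λ i → ℕ→ℚ (suc n ∸ i) * T i) + 0ℚ
      ≡⟨ +-identityʳ _ ⟩
    sumTo n (λ i → ℕ→ℚ (suc n ∸ i) * T i)
      ≡⟨ sumTo-cong n (λ i i≤n → trans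
           (cong (λ j → ℕ→ℚ j * (f i * g j)) (ℕ.+-∸-assoc 1 i≤n))
           (exchange (ℕ→ℚ (suc (n ∸ i))) (f i) (g (suc (n ∸ i))))) ⟩
    (f ⊛ ∂ g) n ∎

^S-vanishes-below : ∀ (f : Series) → f 0 ≡ 0ℚ → ∀ k j → j < k → (f ^S k) j ≡ 0ℚ
^S-vanishes-below f f0≡0 (suc k) j (s≤s j≤k) = sumTo-zero j term-vanishes
  where
  term-vanishes : ∀ i → i ≤ j → (f ^S k) i * f (j ∸ i) ≡ 0ℚ
  term-vanishes i i≤j with i ℕ.<? k
  ... | yes i<k = trans (cong (_* f (j ∸ i)) (^S-vanishes-below f f0≡0 k i i<k)) (*-zeroˡ (f (j ∸ i)))
  ... | no  i≮k = trans (cong (λ t → (f ^S k) i * f t) (ℕ.m≤n⇒m∸n≡0 (ℕ.≤-trans j≤k (ℕ.≮⇒≥ i≮k))))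
                    (trans (cong ((f ^S k) i *_) f0≡0) (*-zeroʳ ((f ^S k) i)))

poly-*-linear-factor : ∀ n y N (c d : ℕ → ℚ) → c (suc n) ≡ 0ℚ →
  d 0 ≡ - (N * c 0) → (∀ m → d (suc m) ≡ c m - N * c (suc m)) →
  sumTo (suc n) (λ m → d m * y ^ℚ m) ≡ sumTo n (λ m → c m * y ^ℚ m) * (y - N)
poly-*-linear-factor n y N c d top d0 d-suc = begin
  sumTo (suc n) (λ m → d m * y ^ℚ m)
    ≡⟨ sumTo-suc-shift n (λ m → d m * y ^ℚ m) ⟩
  d 0 * 1ℚ + sumTo n (λ m → d (suc m) * y ^ℚ suc m)
    ≡⟨ cong₂ _+_ (cong (_* 1ℚ) d0) (sumTo-cong n (λ m _ → trans (cong (_* y ^ℚ suc m) (d-suc m))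
                                                          (expand (c m) (c (suc m)) N (y ^ℚ m) y))) ⟩
  - (N * c 0) * 1ℚ + sumTo n (λ m → c m * y ^ℚ m * y - N * (c (suc m) * y ^ℚ suc m))
    ≡⟨ cong (_+_ (- (N * c 0) * 1ℚ)) (trans (sumTo-sub n _ _)
         (cong₂ _-_ (sym (sumTo-*ʳ n y _)) (sym (sumTo-*ˡ n N _)))) ⟩
  - (N * c 0) * 1ℚ + (P * y - N * R)
    ≡⟨ cong (λ p → - (N * c 0) * 1ℚ + (p * y - N * R)) P≡c0+R ⟩
  - (N * c 0) * 1ℚ + ((c 0 * 1ℚ + R) * y - N * R)
    ≡⟨ collect (c 0) R y N ⟩
  (c 0 * 1ℚ + R) * (y - N)
    ≡⟨ cong (_* (y - N)) P≡c0+R ⟨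
  P * (y - N) ∎
  where
  P R : ℚ
  P = sumTo n (λ m → c m * y ^ℚ m)
  R = sumTo n (λ m → c (suc m) * y ^ℚ suc m)
  expand : ∀ a b N p y → (a - N * b) * (p * y) ≡ a * p * y - N * (b * (p * y))
  expand = solve-∀ ℚ-ring
  collect : ∀ a r y N → - (N * a) * 1ℚ + ((a * 1ℚ + r) * y - N * r) ≡ (a * 1ℚ + r) * (y - N)
  collect = solve-∀ ℚ-ring
  P≡c0+R : P ≡ c 0 * 1ℚ + R
  P≡c0+R = begin
    P                                 ≡⟨ +-identityʳ P ⟨
    P + 0ℚ                            ≡⟨ cong (_+_ P) (trans (cong (_* y ^ℚ suc n) top) (*-zeroˡ (y ^ℚ suc n))) ⟨
    sumTo (suc n) (λ m → c m * y ^ℚ m) ≡⟨ sumTo-suc-shift n (λ m → c m * y ^ℚ m) ⟩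
    c 0 * 1ℚ + R                      ∎

S₁-vanishes : ∀ {n m} → n < m → S₁ n m ≡ + 0
S₁-vanishes {zero}  {suc m} _ = refl
S₁-vanishes {suc n} {suc m} (s≤s n<m)
  rewrite S₁-vanishes n<m | S₁-vanishes (ℕ.m≤n⇒m≤1+n n<m) | ℤ.*-zeroʳ (+ n) = refl

module Degenerate (lam : ℚ) where

  fallλ : ℚ → ℕ → ℚ
  fallλ y zero    = 1ℚ
  fallλ y (suc n) = fallλ y n * (y - ℕ→ℚ n * lam)

  fallλ-coeff : ℕ → ℕ → ℚ
  fallλ-coeff n m = lam ^ℚ (n ∸ m) * ℤ→ℚ (S₁ n m)

  fallλ-coeff-vanishes : ∀ n → fallλ-coeff n (suc n) ≡ 0ℚ
  fallλ-coeff-vanishes n rewrite S₁-vanishes (ℕ.n<1+n n) = *-zeroʳ (lam ^ℚ (n ∸ suc n))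

  fallλ-coeff-suc-zero : ∀ n → fallλ-coeff (suc n) 0 ≡ - (ℕ→ℚ n * lam * fallλ-coeff n 0)
  fallλ-coeff-suc-zero n = trans
    (cong (lam ^ℚ n * lam *_) (trans (ℤ→ℚ-homo‿- (+ n ℤ.* S₁ n 0)) (cong -_ (ℤ→ℚ-homo-* (+ n) (S₁ n 0)))))
    (reassoc (lam ^ℚ n) lam (ℕ→ℚ n) (ℤ→ℚ (S₁ n 0)))
    where
    reassoc : ∀ p l a s → p * l * - (a * s) ≡ - (a * l * (p * s))
    reassoc = solve-∀ ℚ-ring

  lam^[n∸m]*S₁[n,1+m] : ∀ n m → lam ^ℚ (n ∸ m) * ℤ→ℚ (S₁ n (suc m)) ≡ lam * fallλ-coeff n (suc m)
  lam^[n∸m]*S₁[n,1+m] n m with m ℕ.<? n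
  ... | yes m<n rewrite ℕ.+-∸-assoc 1 m<n = reassoc (lam ^ℚ (n ∸ suc m)) lam (ℤ→ℚ (S₁ n (suc m)))
    where
    reassoc : ∀ p l s → p * l * s ≡ l * (p * s)
    reassoc = solve-∀ ℚ-ring
  ... | no m≮n rewrite S₁-vanishes (s≤s (ℕ.≮⇒≥ m≮n)) =
    trans (*-zeroʳ (lam ^ℚ (n ∸ m))) (sym (trans (cong (lam *_) (*-zeroʳ (lam ^ℚ (n ∸ suc m)))) (*-zeroʳ lam)))

  fallλ-coeff-suc : ∀ n m → fallλ-coeff (suc n) (suc m) ≡ fallλ-coeff n m - ℕ→ℚ n * lam * fallλ-coeff n (suc m)
  fallλ-coeff-suc n m = begin
    lam ^ℚ (n ∸ m) * ℤ→ℚ (S₁ n m ℤ.- + n ℤ.* S₁ n (suc m))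
      ≡⟨ cong (lam ^ℚ (n ∸ m) *_) (trans (ℤ→ℚ-homo-sub (S₁ n m) (+ n ℤ.* S₁ n (suc m)))
           (cong (_-_ (ℤ→ℚ (S₁ n m))) (ℤ→ℚ-homo-* (+ n) (S₁ n (suc m))))) ⟩
    lam ^ℚ (n ∸ m) * (ℤ→ℚ (S₁ n m) - ℕ→ℚ n * ℤ→ℚ (S₁ n (suc m)))
      ≡⟨ distrib (lam ^ℚ (n ∸ m)) (ℤ→ℚ (S₁ n m)) (ℕ→ℚ n) (ℤ→ℚ (S₁ n (suc m))) ⟩
    fallλ-coeff n m - ℕ→ℚ n * (lam ^ℚ (n ∸ m) * ℤ→ℚ (S₁ n (suc m)))
      ≡⟨ cong (λ t → fallλ-coeff n m - ℕ→ℚ n * t) (lam^[n∸m]*S₁[n,1+m] n m) ⟩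
    fallλ-coeff n m - ℕ→ℚ n * (lam * fallλ-coeff n (suc m))
      ≡⟨ cong (λ t → fallλ-coeff n m - t) (*-assoc (ℕ→ℚ n) lam (fallλ-coeff n (suc m))) ⟨
    fallλ-coeff n m - ℕ→ℚ n * lam * fallλ-coeff n (suc m) ∎
    where
    distrib : ∀ p a b s → p * (a - b * s) ≡ p * a - b * (p * s)
    distrib = solve-∀ ℚ-ring

  fallλ-stirling : ∀ y n → sumTo n (λ m → fallλ-coeff n m * y ^ℚ m) ≡ fallλ y n
  fallλ-stirling y zero    = refl
  fallλ-stirling y (suc n) = trans
    (poly-*-linear-factor n y (ℕ→ℚ n * lam) (fallλ-coeff n) (fallλ-coeff (suc n))
      (fallλ-coeff-vanishes n) (fallλ-coeff-suc-zero n) (fallλ-coeff-suc n))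
    (cong (_* (y - ℕ→ℚ n * lam)) (fallλ-stirling y n))

  sumTo-Δ^-S₁≡Δ^fallλ : ∀ x n k →
    sumTo n (λ m → inv! k * Δ^ k (λ y → y ^ℚ m) x * (lam ^ℚ (n ∸ m)) * ℤ→ℚ (S₁ n m))
      ≡ inv! k * Δ^ k (λ y → fallλ y n) x
  sumTo-Δ^-S₁≡Δ^fallλ x n k = begin
    sumTo n (λ m → inv! k * Δ^ k (λ y → y ^ℚ m) x * (lam ^ℚ (n ∸ m)) * ℤ→ℚ (S₁ n m))
      ≡⟨ sumTo-cong n (λ m _ → reassoc (inv! k) (Δ^ k (λ y → y ^ℚ m) x) (lam ^ℚ (n ∸ m)) (ℤ→ℚ (S₁ n m))) ⟩
    sumTo n (λ m → inv! k * (fallλ-coeff n m * Δ^seq k (λ l → (x + ℕ→ℚ l) ^ℚ m)))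
      ≡⟨ sumTo-*ˡ n (inv! k) _ ⟨
    inv! k * sumTo n (λ m → fallλ-coeff n m * Δ^seq k (λ l → (x + ℕ→ℚ l) ^ℚ m))
      ≡⟨ cong (inv! k *_) (sumTo-cong n (λ m _ → Δ^seq-*ˡ k (fallλ-coeff n m) _)) ⟩
    inv! k * sumTo n (λ m → Δ^seq k (λ l → fallλ-coeff n m * (x + ℕ→ℚ l) ^ℚ m))
      ≡⟨ cong (inv! k *_) (Δ^seq-sum n k _) ⟩
    inv! k * Δ^seq k (λ l → sumTo n (λ m → fallλ-coeff n m * (x + ℕ→ℚ l) ^ℚ m))
      ≡⟨ cong (inv! k *_) (Δ^seq-cong k (λ l → fallλ-stirling (x + ℕ→ℚ l) n)) ⟩
    inv! k * Δ^ k (λ y → fallλ y n) x ∎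
    where
    reassoc : ∀ a d p s → a * d * p * s ≡ a * (p * s * d)
    reassoc = solve-∀ ℚ-ring

  fallλ-scale : ∀ a m → fallℚ a m * lam ^ℚ m ≡ fallλ (a * lam) m
  fallλ-scale a zero    = refl
  fallλ-scale a (suc m) = trans (reassoc (fallℚ a m) a (ℕ→ℚ m) (lam ^ℚ m) lam)
                                (cong (_* (a * lam - ℕ→ℚ m * lam)) (fallλ-scale a m))
    where
    reassoc : ∀ f a j p l → f * (a - j) * (p * l) ≡ f * p * (a * l - j * l)
    reassoc = solve-∀ ℚ-ring

  fallλ-zero : ∀ n → fallλ 0ℚ (suc n) ≡ 0ℚ
  fallλ-zero zero    = cong (λ t → 1ℚ * (0ℚ - t)) (*-zeroˡ lam)
  fallλ-zero (suc n) = trans (cong (_* (0ℚ - ℕ→ℚ (suc n) * lam)) (fallλ-zero n)) (*-zeroˡ (0ℚ - ℕ→ℚ (suc n) * lam))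

  eλ : ℚ → Series
  eλ y n = fallλ y n * inv! n

  eλ-zero : ∀ n → eλ 0ℚ n ≡ oneS n
  eλ-zero zero    = refl
  eλ-zero (suc n) = trans (cong (_* inv! (suc n)) (fallλ-zero n)) (*-zeroˡ (inv! (suc n)))

  ∂-eλ : ∀ y n → ∂ (eλ y) n ≡ eλ y n * (y - ℕ→ℚ n * lam)
  ∂-eλ y n = trans (reassoc (ℕ→ℚ (suc n)) (fallλ y n) (y - ℕ→ℚ n * lam) (inv! (suc n)))
                   (cong (λ i → fallλ y n * i * (y - ℕ→ℚ n * lam)) ([1+n]*inv![1+n]≡inv!n n))
    where
    reassoc : ∀ s f c i → s * (f * c * i) ≡ f * (s * i) * c
    reassoc = solve-∀ ℚ-ring

  eλ-unique : ∀ y (h : Series) → h 0 ≡ 1ℚ → (∀ n → ∂ h n ≡ h n * (y - ℕ→ℚ n * lam)) → ∀ n → h n ≡ eλ y n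
  eλ-unique y h h0 ∂h zero    = h0
  eλ-unique y h h0 ∂h (suc n) = ℕ→ℚ-*-cancelˡ (suc n) (begin
    ∂ h n                          ≡⟨ ∂h n ⟩
    h n * (y - ℕ→ℚ n * lam)        ≡⟨ cong (_* (y - ℕ→ℚ n * lam)) (eλ-unique y h h0 ∂h n) ⟩
    eλ y n * (y - ℕ→ℚ n * lam)     ≡⟨ ∂-eλ y n ⟨
    ∂ (eλ y) n                     ∎)

  eλ-+ : ∀ a b n → (eλ a ⊛ eλ b) n ≡ eλ (a + b) n
  eλ-+ a b = eλ-unique (a + b) (eλ a ⊛ eλ b) refl ∂-product
    where
    collect : ∀ u v a b p q l → u * (a - p * l) * v + u * (v * (b - q * l)) ≡ u * v * (a + b - (p + q) * l)
    collect = solve-∀ ℚ-ring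
    term : ∀ n i → i ≤ n → ∂ (eλ a) i * eλ b (n ∸ i) + eλ a i * ∂ (eλ b) (n ∸ i)
                           ≡ eλ a i * eλ b (n ∸ i) * (a + b - ℕ→ℚ n * lam)
    term n i i≤n = begin
      ∂ (eλ a) i * eλ b (n ∸ i) + eλ a i * ∂ (eλ b) (n ∸ i)
        ≡⟨ cong₂ (λ u v → u * eλ b (n ∸ i) + eλ a i * v) (∂-eλ a i) (∂-eλ b (n ∸ i)) ⟩
      eλ a i * (a - ℕ→ℚ i * lam) * eλ b (n ∸ i) + eλ a i * (eλ b (n ∸ i) * (b - ℕ→ℚ (n ∸ i) * lam))
        ≡⟨ collect (eλ a i) (eλ b (n ∸ i)) a b (ℕ→ℚ i) (ℕ→ℚ (n ∸ i)) lam ⟩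
      eλ a i * eλ b (n ∸ i) * (a + b - (ℕ→ℚ i + ℕ→ℚ (n ∸ i)) * lam)
        ≡⟨ cong (λ t → eλ a i * eλ b (n ∸ i) * (a + b - t * lam))
             (trans (sym (ℕ→ℚ-homo-+ i (n ∸ i))) (cong ℕ→ℚ (ℕ.m+[n∸m]≡n i≤n))) ⟩
      eλ a i * eλ b (n ∸ i) * (a + b - ℕ→ℚ n * lam) ∎
    ∂-product : ∀ n → ∂ (eλ a ⊛ eλ b) n ≡ (eλ a ⊛ eλ b) n * (a + b - ℕ→ℚ n * lam)
    ∂-product n = begin
      ∂ (eλ a ⊛ eλ b) n                                ≡⟨ ∂-leibniz (eλ a) (eλ b) n ⟩
      (∂ (eλ a) ⊛ eλ b) n + (eλ a ⊛ ∂ (eλ b)) n        ≡⟨ sumTo-+ n _ _ ⟨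
      sumTo n (λ i → ∂ (eλ a) i * eλ b (n ∸ i) + eλ a i * ∂ (eλ b) (n ∸ i))
                                                       ≡⟨ sumTo-cong n (term n) ⟩
      sumTo n (λ i → eλ a i * eλ b (n ∸ i) * (a + b - ℕ→ℚ n * lam))
                                                       ≡⟨ sumTo-*ʳ n _ _ ⟨
      (eλ a ⊛ eλ b) n * (a + b - ℕ→ℚ n * lam)          ∎

module _ (lam : ℚ) .{{_ : NonZero lam}} where
  open Degenerate lam

  binomSeries≡eλ : ∀ a m → binomSeries lam a m ≡ eλ (a * lam) m
  binomSeries≡eλ a m = trans (swap (fallℚ a m) (inv! m) (lam ^ℚ m)) (cong (_* inv! m) (fallλ-scale a m))
    where
    swap : ∀ f i p → f * i * p ≡ f * p * i
    swap = solve-∀ ℚ-ring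

  eλ-minus-one : Series
  eλ-minus-one m = binomSeries lam (1/ lam) m - oneS m

  eλ-minus-one≡eλ1-eλ0 : ∀ m → eλ-minus-one m ≡ eλ 1ℚ m - eλ 0ℚ m
  eλ-minus-one≡eλ1-eλ0 m = cong₂ _-_
    (trans (binomSeries≡eλ (1/ lam) m) (cong (λ a → eλ a m) (*-inverseˡ lam)))
    (sym (eλ-zero m))

  eλ-⊛-minus-one : ∀ a m → (eλ a ⊛ eλ-minus-one) m ≡ eλ (a + 1ℚ) m - eλ a m
  eλ-⊛-minus-one a m = begin
    sumTo m (λ i → eλ a i * eλ-minus-one (m ∸ i))
      ≡⟨ sumTo-cong m (λ i _ → trans (cong (eλ a i *_) (eλ-minus-one≡eλ1-eλ0 (m ∸ i)))
                                     (distrib (eλ a i) (eλ 1ℚ (m ∸ i)) (eλ 0ℚ (m ∸ i)))) ⟩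
    sumTo m (λ i → eλ a i * eλ 1ℚ (m ∸ i) - eλ a i * eλ 0ℚ (m ∸ i))
      ≡⟨ sumTo-sub m _ _ ⟩
    (eλ a ⊛ eλ 1ℚ) m - (eλ a ⊛ eλ 0ℚ) m
      ≡⟨ cong₂ _-_ (eλ-+ a 1ℚ m) (trans (eλ-+ a 0ℚ m) (cong (λ b → eλ b m) (+-identityʳ a))) ⟩
    eλ (a + 1ℚ) m - eλ a m ∎
    where
    distrib : ∀ c u v → c * (u - v) ≡ c * u - c * v
    distrib = solve-∀ ℚ-ring

  eλ-minus-one-^S : ∀ k m → (eλ-minus-one ^S k) m ≡ Δ^seq k (λ l → eλ (ℕ→ℚ l) m)
  eλ-minus-one-^S zero    m = sym (trans (*-identityˡ (eλ 0ℚ m)) (eλ-zero m))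
  eλ-minus-one-^S (suc k) m = begin
    sumTo m (λ i → (eλ-minus-one ^S k) i * eλ-minus-one (m ∸ i))
      ≡⟨ sumTo-cong m (λ i _ → trans (cong (_* eλ-minus-one (m ∸ i)) (eλ-minus-one-^S k i))
                                     (Δ^seq-*ʳ k (eλ-minus-one (m ∸ i)) _)) ⟩
    sumTo m (λ i → Δ^seq k (λ l → eλ (ℕ→ℚ l) i * eλ-minus-one (m ∸ i)))
      ≡⟨ Δ^seq-sum m k _ ⟩
    Δ^seq k (λ l → (eλ (ℕ→ℚ l) ⊛ eλ-minus-one) m)
      ≡⟨ Δ^seq-cong k (λ l → trans (eλ-⊛-minus-one (ℕ→ℚ l) m)
                                   (cong (λ a → eλ a m - eλ (ℕ→ℚ l) m) (sym (ℕ→ℚ-suc l)))) ⟩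
    Δ^seq k (λ l → eλ (ℕ→ℚ (suc l)) m - eλ (ℕ→ℚ l) m)
      ≡⟨ Δ^seq-suc k (λ l → eλ (ℕ→ℚ l) m) ⟨
    Δ^seq (suc k) (λ l → eλ (ℕ→ℚ l) m) ∎

  binomSeries-⊛-minus-one-^S : ∀ x k n →
    (binomSeries lam (x ÷ lam) ⊛ (eλ-minus-one ^S k)) n ≡ Δ^seq k (λ l → eλ (x + ℕ→ℚ l) n)
  binomSeries-⊛-minus-one-^S x k n = begin
    sumTo n (λ i → binomSeries lam (x ÷ lam) i * (eλ-minus-one ^S k) (n ∸ i))
      ≡⟨ sumTo-cong n (λ i _ → cong₂ _*_ (binomSeries-÷ i) (eλ-minus-one-^S k (n ∸ i))) ⟩
    sumTo n (λ i → eλ x i * Δ^seq k (λ l → eλ (ℕ→ℚ l) (n ∸ i)))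
      ≡⟨ sumTo-cong n (λ i _ → Δ^seq-*ˡ k (eλ x i) _) ⟩
    sumTo n (λ i → Δ^seq k (λ l → eλ x i * eλ (ℕ→ℚ l) (n ∸ i)))
      ≡⟨ Δ^seq-sum n k _ ⟩
    Δ^seq k (λ l → (eλ x ⊛ eλ (ℕ→ℚ l)) n)
      ≡⟨ Δ^seq-cong k (λ l → eλ-+ x (ℕ→ℚ l) n) ⟩
    Δ^seq k (λ l → eλ (x + ℕ→ℚ l) n) ∎
    where
    binomSeries-÷ : ∀ i → binomSeries lam (x ÷ lam) i ≡ eλ x i
    binomSeries-÷ i = trans (binomSeries≡eλ (x ÷ lam) i) (cong (λ a → eλ a i)
      (trans (*-assoc x (1/ lam) lam) (trans (cong (x *_) (*-inverseˡ lam)) (*-identityʳ x))))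

  S₂λ≡Δ^fallλ : ∀ x n k → S₂λ lam n k x ≡ inv! k * Δ^ k (λ y → fallλ y n) x
  S₂λ≡Δ^fallλ x n k = begin
    ℕ→ℚ (n !) * (inv! k * (binomSeries lam (x ÷ lam) ⊛ (eλ-minus-one ^S k)) n)
      ≡⟨ cong (λ s → ℕ→ℚ (n !) * (inv! k * s))
           (trans (binomSeries-⊛-minus-one-^S x k n) (sym (Δ^seq-*ʳ k (inv! n) _))) ⟩
    ℕ→ℚ (n !) * (inv! k * (D * inv! n))
      ≡⟨ reassoc (ℕ→ℚ (n !)) (inv! k) D (inv! n) ⟩
    inv! k * D * (ℕ→ℚ (n !) * inv! n)
      ≡⟨ cong (inv! k * D *_) (n!*inv!n≡1 n) ⟩
    inv! k * D * 1ℚ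
      ≡⟨ *-identityʳ (inv! k * D) ⟩
    inv! k * D ∎
    where
    D : ℚ
    D = Δ^ k (λ y → fallλ y n) x
    reassoc : ∀ a b d c → a * (b * (d * c)) ≡ b * d * (a * c)
    reassoc = solve-∀ ℚ-ring

  S₂λ-vanishes : ∀ x n k → n < k → S₂λ lam n k x ≡ 0ℚ
  S₂λ-vanishes x n k n<k = begin
    ℕ→ℚ (n !) * (inv! k * (binomSeries lam (x ÷ lam) ⊛ (eλ-minus-one ^S k)) n)
      ≡⟨ cong (λ s → ℕ→ℚ (n !) * (inv! k * s)) (sumTo-zero n term-vanishes) ⟩
    ℕ→ℚ (n !) * (inv! k * 0ℚ)
      ≡⟨ trans (cong (ℕ→ℚ (n !) *_) (*-zeroʳ (inv! k))) (*-zeroʳ (ℕ→ℚ (n !))) ⟩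
    0ℚ ∎
    where
    term-vanishes : ∀ i → i ≤ n → binomSeries lam (x ÷ lam) i * (eλ-minus-one ^S k) (n ∸ i) ≡ 0ℚ
    term-vanishes i _ = trans
      (cong (binomSeries lam (x ÷ lam) i *_)
        (^S-vanishes-below eλ-minus-one refl k (n ∸ i) (ℕ.≤-<-trans (ℕ.m∸n≤m n i) n<k)))
      (*-zeroʳ (binomSeries lam (x ÷ lam) i))

theorem2 : (lam : ℚ) → .{{_ : NonZero lam}} → (x : ℚ) → (n k : ℕ) →
    let lhs = sumTo n (λ m → inv! k * Δ^ k (λ y → y ^ℚ m) x * (lam ^ℚ (n ∸ m)) * ℤ→ℚ (S₁ n m))
    in (k ≤ n → lhs ≡ S₂λ lam n k x) × (n < k → lhs ≡ 0ℚ)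
theorem2 lam x n k = (λ _ → lhs≡S₂λ) , (λ n<k → trans lhs≡S₂λ (S₂λ-vanishes lam x n k n<k))
  where
  lhs≡S₂λ : sumTo n (λ m → inv! k * Δ^ k (λ y → y ^ℚ m) x * (lam ^ℚ (n ∸ m)) * ℤ→ℚ (S₁ n m)) ≡ S₂λ lam n k x
  lhs≡S₂λ = trans (Degenerate.sumTo-Δ^-S₁≡Δ^fallλ lam x n k) (sym (S₂λ≡Δ^fallλ lam x n k))
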